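{- Let $\langle \mathrm{VAR},\mathrm{CON},\mathrm{FUN},\mathrm{REL},\mathrm{type}\rangle$ be a signature, $x\in\mathrm{VAR}$, $c\in\mathrm{CON}$ with $\mathrm{type}(x)=\mathrm{type}(c)$, and $P\in\mathrm{REL}$ with $\mathrm{type}(P)=\langle\mathsf{agtobj}\rangle$. Then the formula $x=c\to(P(x)\to P(c))$ is not valid in the non-standard semantics.
   Context: Types $\mathsf{TYPE}=\{\mathsf{agt},\mathsf{obj},\mathsf{agtobj}\}$ ordered by the reflexive order $\preccurlyeq$ with $\mathsf{agt}\preccurlyeq\mathsf{agtobj}$, $\mathsf{obj}\preccurlyeq\mathsf{agtobj}$. A signature $\langle \mathrm{VAR},\mathrm{CON},\mathrm{FUN},\mathrm{REL},\mathrm{type}\rangle$: variables typed $\mathsf{agt}$ or $\mathsf{obj}$ (infinitely many of each), constants typed $\mathsf{agt}$ or $\mathsf{obj}$, function symbols typed $\langle\tau_1,\dots,\tau_n,\tau_{n+1}\rangle$ with $\tau_{n+1}\in\{\mathsf{agt},\mathsf{obj}\}$, relation symbols typed in $\mathsf{TYPE}^n$, with $=\in\mathrm{REL}$ typed $\langle\mathsf{agtobj},\mathsf{agtobj}\rangle$. Atomic formulas $P(t_1,\dots,t_n)$ require the type of $t_i$ to be $\preccurlyeq$ the $i$-th argument type of $P$; formulas are closed under $\neg,\wedge$, $K_s$ (for terms $s$ of type $\mathsf{agt}$) and $\forall x$; $\varphi\to\psi:=\neg(\varphi\wedge\neg\psi)$. Non-standard semantics: a non-standard model $N=\langle D,W,R,J\rangle$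 has $D=D_{\mathsf{agtobj}}=D_{\mathsf{agt}}\sqcup D_{\mathsf{obj}}$ (nonempty disjoint sets), nonempty $W$, $R_i\subseteq W\times W$ for $i\in D_{\mathsf{agt}}$, and $J$ with: $J(c,w,X)\in D_{\mathrm{type}(c)}$ for every constant $c$, world $w$ and every $X\subseteq D^n$ ($n\in\mathbb{N}$ arbitrary); $J(f,w,X):D_{\tau_1}\times\cdots\times D_{\tau_n}\to D_{\tau_{n+1}}$ for each such $X$, where $\mathrm{type}(f)=\langle\tau_1,\dots,\tau_{n+1}\rangle$; $J(=,w)=\{\langle d,d\rangle:d\in D\}$; $J(P,w)\subseteq D_{\tau_1}\times\cdots\times D_{\tau_n}$ for other $P$ typed $\langle\tau_1,\dots,\tau_n\rangle$. Valuations $v:\mathrm{VAR}\to D$ with $v(x)\in D_{\mathrm{type}(x)}$. Term extensions: $[\![x]\!]^{J,v}_{w,X}=v(x)$, $[\![c]\!]^{J,v}_{w,X}=J(c,w,X)$, $[\![f(t_1,\dots,t_n)]\!]^{J,v}_{w,X}=J(f,w,X)([\![t_1]\!]^{J,v}_{w,X},\dots,[\![t_n]\!]^{J,v}_{w,X})$. Satisfaction: $N,w\models_vP(t_1,\dots,t_n)$ iff $\langle[\![t_1]\!]^{J,v}_{w,J(P,w)},\dots,[\![t_n]\!]^{J,v}_{w,J(P,w)}\rangle\in J(P,w)$ ($P$ may be $=$); $\neg,\wedge$ classical; $N,w\models_v\forall x\varphi$ iff $N,w\models_{v[x\mapsto d]}\varphi$ for all $d\in D_{\mathrm{type}(x)}$;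 $N,w\models_vK_t\varphi$ iff $N,w'\models_v\varphi$ for all $w'$ with $\langle w,w'\rangle\in R_{[\![t]\!]^{J,v}_{w,\emptyset}}$. A formula is valid in the non-standard semantics if it is satisfied at every world of every non-standard model under every valuation. -}

module Defs where

open import Data.Nat using (ℕ)
open import Data.List using (List; []; _∷_; length)
open import Data.Vec using (Vec; []; _∷_)
open import Data.Product using (Σ; _×_; _,_)
open import Data.Sum using (_⊎_; inj₁; inj₂)
open import Data.Unit using (⊤; tt)
open import Data.Empty using (⊥)
open import Relation.Nullary using (¬_)
open import Relation.Binary.PropositionalEquality using (_≡_; _≢_; subst; sym)
open import Function.Bundles using (_⇔_)

data TYPE : Set where
  agt obj agtobj : TYPE

data _≼_ : TYPE → TYPE → Set where
  ≼-refl     : ∀ {τ} → τ ≼ τ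
  agt≼agtobj : agt ≼ agtobj
  obj≼agtobj : obj ≼ agtobj

data BType : Set where
  agt obj : BType

⌜_⌝ : BType → TYPE
⌜ agt ⌝ = agt
⌜ obj ⌝ = obj

-- A signature ⟨VAR, CON, FUN, REL, type⟩.  The relation symbols other than
-- '=' are collected in RSym; the full set REL (containing '=') is defined below.
record Signature : Set₁ where
  field
    VAR  : Set
    CON  : Set
    FUN  : Set
    RSym : Set
    vtype : VAR → BType
    ctype : CON → BType
    fargs : FUN → List TYPE
    fres  : FUN → BType
    rtype' : RSym → List TYPE
    varsInf : (b : BType) →
      Σ (ℕ → VAR) λ g → (∀ m n → g m ≡ g n → m ≡ n) × (∀ n → vtype (g n) ≡ b)

open Signature public

data REL (S : Signature) : Set where
  eqR : REL S
  rel : RSym S → REL S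

rtype : {S : Signature} → REL S → List TYPE
rtype eqR     = agtobj ∷ agtobj ∷ []
rtype {S} (rel p) = rtype' S p

module _ (S : Signature) where

  mutual
    data Term : BType → Set where
      var : (x : VAR S) → Term (vtype S x)
      con : (c : CON S) → Term (ctype S c)
      app : (f : FUN S) → Args (fargs S f) → Term (fres S f)

    data Args : List TYPE → Set where
      []  : Args []
      _∷⟨_⟩_ : ∀ {b τ τs} → Term b → ⌜ b ⌝ ≼ τ → Args τs → Args (τ ∷ τs)

  data Formula : Set where
    atom : (P : REL S) → Args (rtype P) → Formula
    ¬'_  : Formula → Formula
    _∧'_ : Formula → Formula → Formula
    K    : Term agt → Formula → Formula
    ∀'   : VAR S → Formula → Formula

  _⇒'_ : Formula → Formula → Formula
  φ ⇒' ψ = ¬' (φ ∧' (¬' ψ))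

Dom : (A B : Set) → TYPE → Set
Dom A B agt    = A
Dom A B obj    = B
Dom A B agtobj = A ⊎ B

Tuple : (A B : Set) → List TYPE → Set
Tuple A B []       = ⊤
Tuple A B (τ ∷ τs) = Dom A B τ × Tuple A B τs

cast : ∀ {A B τ σ} → τ ≼ σ → Dom A B τ → Dom A B σ
cast ≼-refl     d = d
cast agt≼agtobj d = inj₁ d
cast obj≼agtobj d = inj₂ d

≼-top : ∀ τ → τ ≼ agtobj
≼-top agt    = agt≼agtobj
≼-top obj    = obj≼agtobj
≼-top agtobj = ≼-refl

toVec : ∀ {A B} τs → Tuple A B τs → Vec (A ⊎ B) (length τs)
toVec []       tt       = []
toVec (τ ∷ τs) (d , ds) = cast (≼-top τ) d ∷ toVec τs ds

-- A subset X ⊆ Dⁿ is represented by its arity n and a predicate on Dⁿ.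
record Model (S : Signature) : Set₁ where
  field
    Dagt Dobj W : Set
    agt₀ : Dagt
    obj₀ : Dobj
    w₀   : W
    R : Dagt → W → W → Set
    Jc : (c : CON S) → W → (n : ℕ) → (Vec (Dagt ⊎ Dobj) n → Set) →
         Dom Dagt Dobj ⌜ ctype S c ⌝
    Jf : (f : FUN S) → W → (n : ℕ) → (Vec (Dagt ⊎ Dobj) n → Set) →
         Tuple Dagt Dobj (fargs S f) → Dom Dagt Dobj ⌜ fres S f ⌝
    Jr : (p : RSym S) → W → Tuple Dagt Dobj (rtype' S p) → Set
    -- J(c,w,X), J(f,w,X) depend only on the set X (extensionality)
    Jc-ext : ∀ c w n (X Y : Vec (Dagt ⊎ Dobj) n → Set) →
             (∀ v → X v ⇔ Y v) → Jc c w n X ≡ Jc c w n Y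
    Jf-ext : ∀ f w n (X Y : Vec (Dagt ⊎ Dobj) n → Set) →
             (∀ v → X v ⇔ Y v) → ∀ ds → Jf f w n X ds ≡ Jf f w n Y ds

module Semantics {S : Signature} (N : Model S) where
  open Model N

  D : Set
  D = Dagt ⊎ Dobj

  Valuation : Set
  Valuation = (x : VAR S) → Dom Dagt Dobj ⌜ vtype S x ⌝

  JR : (P : REL S) → W → Vec D (length (rtype P)) → Set
  JR eqR     w (d ∷ e ∷ []) = d ≡ e
  JR (rel p) w ds = Σ (Tuple Dagt Dobj (rtype' S p)) λ t →
                      (toVec (rtype' S p) t ≡ ds) × Jr p w t

  mutual
    ⟦_⟧t : ∀ {b} → Term S b → Valuation → W → (n : ℕ) → (Vec D n → Set) →
           Dom Dagt Dobj ⌜ b ⌝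
    ⟦ var x ⟧t    v w n X = v x
    ⟦ con c ⟧t    v w n X = Jc c w n X
    ⟦ app f ts ⟧t v w n X = Jf f w n X (⟦ ts ⟧a v w n X)

    ⟦_⟧a : ∀ {τs} → Args S τs → Valuation → W → (n : ℕ) → (Vec D n → Set) →
           Tuple Dagt Dobj τs
    ⟦ [] ⟧a            v w n X = tt
    ⟦ t ∷⟨ p ⟩ ts ⟧a v w n X = cast p (⟦ t ⟧t v w n X) , ⟦ ts ⟧a v w n X

  ∅ : Vec D 0 → Set
  ∅ _ = ⊥

  _,_⊨_ : W → Valuation → Formula S → Set
  w , v ⊨ atom P ts =
    JR P w (toVec (rtype P) (⟦ ts ⟧a v w (length (rtype P)) (JR P w)))
  w , v ⊨ (¬' φ)    = ¬ (w , v ⊨ φ)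
  w , v ⊨ (φ ∧' ψ)  = (w , v ⊨ φ) × (w , v ⊨ ψ)
  w , v ⊨ K s φ     = ∀ w' → R (⟦ s ⟧t v w 0 ∅) w w' → w' , v ⊨ φ
  -- v[x ↦ d], described relationally
  w , v ⊨ ∀' x φ    = ∀ (d : Dom Dagt Dobj ⌜ vtype S x ⌝) (v' : Valuation) →
                        v' x ≡ d → (∀ y → y ≢ x → v' y ≡ v y) → w , v' ⊨ φ

Valid : {S : Signature} → Formula S → Set₁
Valid {S} φ = (N : Model S) (w : Model.W N) (v : Semantics.Valuation N) →
              Semantics._,_⊨_ N w v φ

eqFormula : (S : Signature) (x : VAR S) (c : CON S) → Formula S
eqFormula S x c =
  atom eqR (var x ∷⟨ ≼-top _ ⟩ (con c ∷⟨ ≼-top _ ⟩ []))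

PFormula : (S : Signature) (P : REL S) → rtype P ≡ agtobj ∷ [] →
           ∀ {b} → Term S b → Formula S
PFormula S P pt t = atom P (subst (Args S) (sym pt) (t ∷⟨ ≼-top _ ⟩ []))

theFormula : (S : Signature) (x : VAR S) (c : CON S) (P : REL S) →
             rtype P ≡ agtobj ∷ [] → Formula S
theFormula S x c P pt =
  _⇒'_ S (eqFormula S x c)
         (_⇒'_ S (PFormula S P pt (var x)) (PFormula S P pt (con c)))

{-# OPTIONS --safe #-}
module Submission where

-- In the non-standard semantics a constant is interpreted relative to the
-- relation of the atom it occurs in.  Take D_agt = D_obj = Bool, let every
-- variable denote true, and let a constant denote true when it is read
-- against a binary relation and false otherwise.  Then in  x = c  the
-- constant c denotes true, so the equation holds (type(x) = type(c) puts
-- both values in the same summand of D), while in the unary atom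
-- P(c) it denotes false; with P interpreted as "every argument is true",
-- P(x) holds and P(c) fails.

open import Defs
open import Relation.Nullary using (¬_)
open import Relation.Binary.PropositionalEquality using (_≡_; refl; cong; subst; sym; trans)
open import Function using (_∘_)
open import Function.Bundles using (_⇔_; mk⇔; Equivalence)
open import Data.Bool using (Bool; true; T)
open import Data.Nat using (_≡ᵇ_)
open import Data.List using ([]; _∷_; length)
open import Data.Vec.Relation.Unary.All using (All; []; _∷_; head)
open import Data.Sum using (reduce)
open import Data.Product using (_,_)
open import Data.Unit using (⊤; tt)

embed : (b : BType) → Bool → Dom Bool Bool ⌜ b ⌝
embed agt β = β
embed obj β = β

reduce-embed : ∀ b β → reduce (cast (≼-top ⌜ b ⌝) (embed b β)) ≡ β
reduce-embed agt β = refl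
reduce-embed obj β = refl

module ArityModel (S : Signature) where

  model : Model S
  model = record
    { Dagt = Bool ; Dobj = Bool ; W = ⊤
    ; agt₀ = true ; obj₀ = true ; w₀ = tt
    ; R = λ _ _ _ → ⊤
    ; Jc = λ c _ n _ → embed (ctype S c) (n ≡ᵇ 2)
    ; Jf = λ f _ _ _ _ → embed (fres S f) true
    ; Jr = λ p _ t → All (T ∘ reduce) (toVec (rtype' S p) t)
    ; Jc-ext = λ _ _ _ _ _ _ → refl
    ; Jf-ext = λ _ _ _ _ _ _ _ → refl
    }

  open Semantics model

  allTrue : Valuation
  allTrue y = embed (vtype S y) true

  eq-holds : ∀ x c → vtype S x ≡ ctype S c → tt , allTrue ⊨ eqFormula S x c
  eq-holds x c x≡c = cong (λ b → cast (≼-top ⌜ b ⌝) (embed b true)) x≡c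

  unary-args⇔ : ∀ ls (ls≡ : ls ≡ agtobj ∷ []) {b} (t : Term S b) n X →
    All (T ∘ reduce) (toVec ls (⟦ subst (Args S) (sym ls≡) (t ∷⟨ ≼-top _ ⟩ []) ⟧a allTrue tt n X))
      ⇔ T (reduce (cast (≼-top ⌜ b ⌝) (⟦ t ⟧t allTrue tt n X)))
  unary-args⇔ _ refl t n X = mk⇔ head (_∷ [])

  unary-atom⇔ : ∀ p (pt : rtype' S p ≡ agtobj ∷ []) {b} (t : Term S b) →
    (tt , allTrue ⊨ PFormula S (rel p) pt t)
      ⇔ T (reduce (cast (≼-top ⌜ b ⌝) (⟦ t ⟧t allTrue tt (length (rtype' S p)) (JR (rel p) tt))))
  unary-atom⇔ p pt t = mk⇔
    (λ { (_ , ≡args , holds) → to (subst (All (T ∘ reduce)) ≡args holds) })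
    (λ holds → _ , refl , from holds)
    where open Equivalence (unary-args⇔ (rtype' S p) pt t _ (JR (rel p) tt))

  P-var-holds : ∀ x p pt → tt , allTrue ⊨ PFormula S (rel p) pt (var x)
  P-var-holds x p pt =
    Equivalence.from (unary-atom⇔ p pt (var x))
      (subst T (sym (reduce-embed (vtype S x) true)) tt)

  P-con-fails : ∀ c p pt → ¬ (tt , allTrue ⊨ PFormula S (rel p) pt (con c))
  P-con-fails c p pt holds =
    subst T (trans (reduce-embed (ctype S c) _) (cong (λ ls → length ls ≡ᵇ 2) pt))
      (Equivalence.to (unary-atom⇔ p pt (con c)) holds)

mainTheorem5 : (S : Signature) (x : VAR S) (c : CON S) →
                 vtype S x ≡ ctype S c →
                 (P : REL S) (pt : rtype P ≡ agtobj ∷ []) →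
                 ¬ Valid (theFormula S x c P pt)
mainTheorem5 S x c x≡c eqR ()
mainTheorem5 S x c x≡c (rel p) pt valid =
  valid model tt allTrue
    (eq-holds x c x≡c , λ notImp → notImp (P-var-holds x p pt , P-con-fails c p pt))
  where open ArityModel S
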